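{- Let $G$ be a claw-free innocent graph. (1) Let $p_1\in V(G)$, let $C$ be a hole in $G\setminus p_1$, and let $P=p_1\hbox{ - }p_2\hbox{ - }\dots\hbox{ - }p_k$ ($k\ge1$) be a path from $p_1$ to $V(C)$. If $k\ge2$ or $p_1$ is safe, then $G|(V(C)\cup\{p_k\})$ is a clown with hat $p_k$; hence, if $p_1$ is safe, then $P$ has odd length. (2) For every safe vertex $v$ and every hole $H$ of $G$, $v\notin V(H)$ and $v$ has no neighbour in $V(H)$. (3) Let $C_1,C_2$ be two vertex-disjoint holes of $G$ with $V(C_1)$ anticomplete to $V(C_2)$, and let $Q=q_1\hbox{ - }\dots\hbox{ - }q_\ell$ ($\ell\ge1$) be a path which is a path from $q_1$ to $V(C_2)$ and also a path from $q_\ell$ to $V(C_1)$. Then $Q$ has even length, $G|(V(C_1)\cup\{q_1\})$ is a clown with hat $q_1$, and $G|(V(C_2)\cup\{q_\ell\})$ is a clown with hat $q_\ell$.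
   Context: Graphs are finite and simple; $N(v)$ denotes neighbourhood. Sets $X,Y$ are anticomplete if disjoint with no edges between them. A stable/clique set is as usual. $G$ is claw-free if it has no induced $K_{1,3}$. A path is a sequence of distinct vertices $p_1\hbox{ - }\dots\hbox{ - }p_k$ with $p_i$ adjacent to $p_j$ iff $|i-j|=1$; its length is $k-1$. A path $p_1\hbox{ - }\dots\hbox{ - }p_k$ from $p_1$ to a set $X$ means $V(P)\cap X=\emptyset$, $V(P)\setminus\{p_k\}$ is anticomplete to $X$, and $p_k$ has a neighbour in $X$. A hole of length $k\ge4$ is an induced $C_k$; antihole: induced complement of $C_k$. A prism: two vertex-disjoint triangles $\{a_1,a_2,a_3\},\{b_1,b_2,b_3\}$ and paths $P_i$ with ends $a_i,b_i$ ($i=1,2,3$) such that for $i<j$ the only edges between $V(P_i),V(P_j)$ are $a_ia_j,b_ib_j$; odd if all $P_i$ odd. A handcuff: two vertex-disjoint even holes $C_1,C_2$ and a disjoint odd-length path $p_1\hbox{ - }\dots\hbox{ - }p_r$ with $p_1$ having exactly two neighbours in $V(C_1)$, adjacent to each other, $p_r$ having exactly two neighbours in $V(C_2)$, adjacent to each other, and no other edges among the three parts. An eye mask: two vertex-disjoint even holes $C_1,C_2$ and edges $x_1y_1\in E(C_1)$, $x_2y_2\in E(C_2)$ with $\{x_1,y_1\}$ complete to $\{x_2,y_2\}$ and no other edges between $V(C_1),V(C_2)$. $G$ is innocent if it contains no odd hole, no antihole of length $\ge6$, no odd prism, no handcuff, no eye mask. A vertex is simplicial if its neighbourhood is a clique.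 A clown is a graph on $\{c_0,\dots,c_k\}$ where $c_1\hbox{ - }\dots\hbox{ - }c_k\hbox{ - }c_1$ is an even hole and $c_0$ is adjacent to exactly $c_1,c_2$ among $c_1,\dots,c_k$; $c_0$ is the hat $h(D)$. A vertex $v$ is safe if it is simplicial and for every clown $D$ (induced subgraph of $G$), every path with ends $v$ and $h(D)$ whose vertex set minus $h(D)$ is disjoint from and anticomplete to $V(D)\setminus\{h(D)\}$ has odd length. -}

module Defs where

open import Data.Bool using (Bool; true; false; T)
open import Data.Nat using (ℕ; zero; suc; _≤_)
open import Data.Nat.Divisibility using (_∣_)
open import Data.Fin using (Fin; zero; suc; toℕ; fromℕ; opposite)
open import Data.Product using (Σ; ∃; _×_; _,_)
open import Data.Sum using (_⊎_)
open import Data.Empty using (⊥)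
open import Relation.Nullary using (¬_)
open import Relation.Binary.PropositionalEquality using (_≡_; _≢_)
open import Function.Bundles using (_⇔_)

record Graph : Set where
  field
    n      : ℕ
    adj    : Fin n → Fin n → Bool
    sym    : ∀ x y → adj x y ≡ adj y x
    irrefl : ∀ x → adj x x ≡ false

V : Graph → Set
V G = Fin (Graph.n G)

Adj : (G : Graph) → V G → V G → Set
Adj G x y = T (Graph.adj G x y)

Even Odd : ℕ → Set
Even m = 2 ∣ m
Odd m = ¬ (2 ∣ m)

Consec : ∀ {k} → Fin k → Fin k → Set
Consec i j = suc (toℕ i) ≡ toℕ j ⊎ suc (toℕ j) ≡ toℕ i

CycAdj : (k : ℕ) → Fin k → Fin k → Set
CycAdj k i j = Consec i j
             ⊎ (toℕ i ≡ 0 × suc (toℕ j) ≡ k)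
             ⊎ (toℕ j ≡ 0 × suc (toℕ i) ≡ k)

module _ (G : Graph) where

  -- a path p_0 - ... - p_len (len+1 distinct vertices, induced); its length is len
  record Path : Set where
    field
      len    : ℕ
      vx     : Fin (suc len) → V G
      inj    : ∀ i j → vx i ≡ vx j → i ≡ j
      adjIff : ∀ i j → Adj G (vx i) (vx j) ⇔ Consec i j

  first last : Path → V G
  first P = Path.vx P zero
  last  P = Path.vx P (fromℕ (Path.len P))

  record Hole : Set where
    field
      len    : ℕ
      len≥4  : 4 ≤ len
      vx     : Fin len → V G
      inj    : ∀ i j → vx i ≡ vx j → i ≡ j
      adjIff : ∀ i j → Adj G (vx i) (vx j) ⇔ CycAdj len i j

  _∈H_ : V G → Hole → Set
  v ∈H C = ∃ λ i → Hole.vx C i ≡ v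

  record Antihole : Set where
    field
      len    : ℕ
      vx     : Fin len → V G
      inj    : ∀ i j → vx i ≡ vx j → i ≡ j
      adjIff : ∀ i j → Adj G (vx i) (vx j) ⇔ (i ≢ j × ¬ CycAdj len i j)

  Anticomplete : (V G → Set) → (V G → Set) → Set
  Anticomplete X Y = ∀ x y → X x → Y y → x ≢ y × ¬ Adj G x y

  TwoAdjNbrs : V G → (V G → Set) → Set
  TwoAdjNbrs v X = Σ (V G) λ x → Σ (V G) λ y →
    X x × X y × x ≢ y × Adj G x y ×
    (∀ u → X u → Adj G v u ⇔ (u ≡ x ⊎ u ≡ y))

  record Prism : Set where
    field
      P     : Fin 3 → Path
      aNb   : ∀ i j → first (P i) ≢ last (P j)
      cross : ∀ i j → i ≢ j → ∀ s t →
                Path.vx (P i) s ≢ Path.vx (P j) t ×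
                (Adj G (Path.vx (P i) s) (Path.vx (P j) t) ⇔
                  ((Path.vx (P i) s ≡ first (P i) × Path.vx (P j) t ≡ first (P j))
                  ⊎ (Path.vx (P i) s ≡ last (P i) × Path.vx (P j) t ≡ last (P j))))

  OddPrism : Set
  OddPrism = Σ Prism λ Π → ∀ i → Odd (Path.len (Prism.P Π i))

  record Handcuff : Set where
    field
      C₁ C₂  : Hole
      even₁  : Even (Hole.len C₁)
      even₂  : Even (Hole.len C₂)
      P      : Path
      oddP   : Odd (Path.len P)
      anti12 : Anticomplete (_∈H C₁) (_∈H C₂)
      disj₁  : ∀ i u → u ∈H C₁ → Path.vx P i ≢ u
      disj₂  : ∀ i u → u ∈H C₂ → Path.vx P i ≢ u
      two₁   : TwoAdjNbrs (first P) (_∈H C₁)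
      two₂   : TwoAdjNbrs (last P) (_∈H C₂)
      none₁  : ∀ i → i ≢ zero → ∀ u → u ∈H C₁ → ¬ Adj G (Path.vx P i) u
      none₂  : ∀ i → i ≢ fromℕ (Path.len P) → ∀ u → u ∈H C₂ → ¬ Adj G (Path.vx P i) u

  record EyeMask : Set where
    field
      C₁ C₂  : Hole
      even₁  : Even (Hole.len C₁)
      even₂  : Even (Hole.len C₂)
      disj   : ∀ u w → u ∈H C₁ → w ∈H C₂ → u ≢ w
      x₁ y₁ x₂ y₂ : V G
      x₁∈ : x₁ ∈H C₁
      y₁∈ : y₁ ∈H C₁
      x₂∈ : x₂ ∈H C₂
      y₂∈ : y₂ ∈H C₂
      e₁  : Adj G x₁ y₁
      e₂  : Adj G x₂ y₂
      edges : ∀ u w → u ∈H C₁ → w ∈H C₂ →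
                Adj G u w ⇔ ((u ≡ x₁ ⊎ u ≡ y₁) × (w ≡ x₂ ⊎ w ≡ y₂))

  record Innocent : Set where
    field
      noOddHole  : (H : Hole) → Odd (Hole.len H) → ⊥
      noAntihole : (A : Antihole) → 6 ≤ Antihole.len A → ⊥
      noOddPrism : OddPrism → ⊥
      noHandcuff : Handcuff → ⊥
      noEyeMask  : EyeMask → ⊥

  ClawFree : Set
  ClawFree = ∀ v a b c → ¬ (Adj G v a × Adj G v b × Adj G v c ×
                            a ≢ b × a ≢ c × b ≢ c ×
                            ¬ Adj G a b × ¬ Adj G a c × ¬ Adj G b c)

  Simplicial : V G → Set
  Simplicial v = ∀ a b → Adj G v a → Adj G v b → a ≢ b → Adj G a b

  -- a clown (as an induced subgraph): hat c_0 plus even hole c_1..c_k,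
  -- hat adjacent exactly to the first two hole vertices
  record Clown : Set where
    field
      hat    : V G
      hole   : Hole
      even   : Even (Hole.len hole)
      hatNot : ¬ (hat ∈H hole)
      hatAdj : ∀ i → Adj G hat (Hole.vx hole i) ⇔ (toℕ i ≡ 0 ⊎ toℕ i ≡ 1)

  IsClownWithHat : (V G → Set) → V G → Set
  IsClownWithHat S h = Σ Clown λ D → Clown.hat D ≡ h ×
    (∀ v → (v ≡ h ⊎ v ∈H Clown.hole D) ⇔ S v)

  Safe : V G → Set
  Safe v = Simplicial v ×
    ((D : Clown) (P : Path) → first P ≡ v → last P ≡ Clown.hat D →
     (∀ i → Path.vx P i ≢ Clown.hat D → ∀ u → u ∈H Clown.hole D →
        Path.vx P i ≢ u × ¬ Adj G (Path.vx P i) u) →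
     Odd (Path.len P))

  -- p_0 - ... - p_m is a path from p_0 to the set X (conditions on the sequence)
  PathTo : ∀ {m} → (Fin (suc m) → V G) → (V G → Set) → Set
  PathTo {m} p X =
    (∀ i x → X x → p i ≢ x) ×
    (∀ i → i ≢ fromℕ m → ∀ x → X x → ¬ Adj G (p i) x) ×
    (∃ λ x → X x × Adj G (p (fromℕ m)) x)

  rev : ∀ {m} → (Fin (suc m) → V G) → Fin (suc m) → V G
  rev p i = p (opposite i)

module Submission where

-- Everything rests on one local fact about a hole C of a claw-free graph G and a vertex
-- x ∉ V(C) with a neighbour on C:
--   if N(x) ∩ V(C) is a clique, then x is adjacent to exactly two vertices of C, and they
--   are consecutive on C.
-- (A neighbour c of x none of whose two hole-neighbours is adjacent to x would be the
-- centre of a claw; a hole vertex adjacent to two consecutive ones is one of them.)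
-- The clique hypothesis holds when x is simplicial, and when x has a neighbour y that is
-- anticomplete to C (otherwise x, y and two nonadjacent hole vertices form a claw).
-- Reading the hole from the two neighbours of x on, G|(V(C) ∪ {x}) is a clown with hat x,
-- since holes of innocent graphs are even.
--   (1) apply this with y the penultimate vertex of P (or x = p₁ simplicial if k = 1);
--       the parity claim is the definition of a safe vertex applied to that clown.
--   (2) a hole vertex is never simplicial; a safe neighbour of a hole would be a path of
--       length 0 to it, which is odd by (1).
--   (3) apply the fact at both ends of Q; an odd Q would complete a handcuff.

open import Defs
open import Data.Nat using (ℕ; zero; suc; _≤_; _<_; _+_; _*_; _∸_; _%_; NonZero; z≤n; s≤s)
open import Data.Nat.Properties
  using (+-comm; +-assoc; m≤m*n; m+[n∸m]≡n; m∸n≤m; <-irrefl; ≤-reflexive; m≤n⇒m<n∨m≡n; n<1+n; n∸n≡0)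
  renaming (_≟_ to _≟ℕ_)
open import Data.Nat.DivMod using (%-distribˡ-+; [m+n]%n≡m%n; [m+kn]%n≡m%n; m<n⇒m%n≡m; m%n%n≡m%n; m%n<n; n%n≡0)
open import Data.Nat.Divisibility using (_∣?_; _∣0)
open import Data.Fin using (Fin; zero; toℕ; fromℕ; fromℕ<; opposite)
import Data.Fin.Properties as FinP
open import Data.Product using (Σ; ∃; _×_; _,_; proj₁; proj₂)
open import Data.Sum as Sum using (_⊎_; inj₁; inj₂; [_,_])
open import Data.Empty using (⊥-elim)
open import Data.Bool using (T)
open import Function using (_∘_; id)
open import Relation.Nullary using (¬_; Dec; yes; no; map′)
open import Relation.Nullary.Decidable.Core using (T?)
open import Relation.Binary.PropositionalEquality using (_≡_; _≢_; refl; sym; trans; cong; subst; subst₂; module ≡-Reasoning)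
open import Function.Bundles using (_⇔_; mk⇔; Equivalence)

open Equivalence using (to; from)

adj-sym : (G : Graph) {x y : V G} → Adj G x y → Adj G y x
adj-sym G {x} {y} = subst T (Graph.sym G x y)

adj? : (G : Graph) (x y : V G) → Dec (Adj G x y)
adj? G x y = T? (Graph.adj G x y)

module Congruence (N : ℕ) .{{_ : NonZero N}} where

  -- a record, so that N is never left to be recovered by unification
  infix 4 _≈_
  record _≈_ (a b : ℕ) : Set where
    constructor mod≡
    field residue≡ : a % N ≡ b % N
  open _≈_ public

  ≈-refl : ∀ {a} → a ≈ a
  ≈-refl = mod≡ refl

  ≈-sym : ∀ {a b} → a ≈ b → b ≈ a
  ≈-sym (mod≡ e) = mod≡ (sym e)

  ≈-trans : ∀ {a b c} → a ≈ b → b ≈ c → a ≈ c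
  ≈-trans (mod≡ e) (mod≡ f) = mod≡ (trans e f)

  ≡⇒≈ : ∀ {a b} → a ≡ b → a ≈ b
  ≡⇒≈ refl = ≈-refl

  _≈?_ : ∀ a b → Dec (a ≈ b)
  a ≈? b = map′ mod≡ residue≡ (a % N ≟ℕ b % N)

  %-≈ : ∀ a → a % N ≈ a
  %-≈ a = mod≡ (m%n%n≡m%n a N)

  +N-≈ : ∀ a → a + N ≈ a
  +N-≈ a = mod≡ ([m+n]%n≡m%n a N)

  +-congʳ : ∀ {a b} r → a ≈ b → a + r ≈ b + r
  +-congʳ {a} {b} r (mod≡ e) = mod≡ (begin
    (a + r) % N         ≡⟨ %-distribˡ-+ a r N ⟩
    (a % N + r % N) % N ≡⟨ cong (λ z → (z + r % N) % N) e ⟩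
    (b % N + r % N) % N ≡⟨ %-distribˡ-+ b r N ⟨
    (b + r) % N         ∎)
    where open ≡-Reasoning

  suc-cong : ∀ {a b} → a ≈ b → suc a ≈ suc b
  suc-cong {a} {b} e = subst₂ _≈_ (+-comm a 1) (+-comm b 1) (+-congʳ 1 e)

  -- neg r is an additive inverse of r: r + neg r is a multiple of N
  neg : ℕ → ℕ
  neg r = r * N ∸ r

  +-neg : ∀ a r → a + r + neg r ≈ a
  +-neg a r = mod≡ (begin
    (a + r + neg r) % N   ≡⟨ cong (_% N) (+-assoc a r (neg r)) ⟩
    (a + (r + neg r)) % N ≡⟨ cong (λ z → (a + z) % N) (m+[n∸m]≡n (m≤m*n r N)) ⟩
    (a + r * N) % N       ≡⟨ [m+kn]%n≡m%n a r N ⟩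
    a % N                 ∎)
    where open ≡-Reasoning

  neg-+ : ∀ a r → a + neg r + r ≈ a
  neg-+ a r = ≈-trans (≡⇒≈ (begin
    a + neg r + r   ≡⟨ +-assoc a (neg r) r ⟩
    a + (neg r + r) ≡⟨ cong (a +_) (+-comm (neg r) r) ⟩
    a + (r + neg r) ≡⟨ +-assoc a r (neg r) ⟨
    a + r + neg r   ∎)) (+-neg a r)
    where open ≡-Reasoning

  cancelʳ : ∀ {a b} r → a + r ≈ b + r → a ≈ b
  cancelʳ {a} {b} r e = ≈-trans (≈-sym (+-neg a r)) (≈-trans (+-congʳ (neg r) e) (+-neg b r))

  suc-cancel : ∀ {a b} → suc a ≈ suc b → a ≈ b
  suc-cancel {a} {b} e = cancelʳ 1 (subst₂ _≈_ (+-comm 1 a) (+-comm 1 b) e)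

  ≈-< : ∀ {a b} → a < N → b < N → a ≈ b → a ≡ b
  ≈-< a<N b<N (mod≡ e) = trans (sym (m<n⇒m%n≡m a<N)) (trans e (m<n⇒m%n≡m b<N))

  offset-injective : ∀ {d e} a → d < N → e < N → d + a ≈ e + a → d ≡ e
  offset-injective a d<N e<N = ≈-< d<N e<N ∘ cancelʳ a

  CycNbr : ℕ → ℕ → Set
  CycNbr a b = suc a ≈ b ⊎ suc b ≈ a

  CycNbr-cong : ∀ {a a′ b b′} → a ≈ a′ → b ≈ b′ → CycNbr a b → CycNbr a′ b′
  CycNbr-cong ea eb (inj₁ e) = inj₁ (≈-trans (≈-sym (suc-cong ea)) (≈-trans e eb))
  CycNbr-cong ea eb (inj₂ e) = inj₂ (≈-trans (≈-sym (suc-cong eb)) (≈-trans e ea))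

  CycNbr-shift : ∀ {a b} r → CycNbr a b → CycNbr (a + r) (b + r)
  CycNbr-shift r = Sum.map (+-congʳ r) (+-congʳ r)

  CycNbr-unshift : ∀ {a b} r → CycNbr (a + r) (b + r) → CycNbr a b
  CycNbr-unshift r = Sum.map (cancelʳ r) (cancelʳ r)

-- The vertices of a hole C of length L, indexed by all of ℕ modulo N = 4 + (L ∸ 4) = L.
module CyclicHole (G : Graph) (C : Hole G) where

  L : ℕ
  L = Hole.len C

  N : ℕ
  N = 4 + (L ∸ 4)

  N≡L : N ≡ L
  N≡L = m+[n∸m]≡n (Hole.len≥4 C)

  open Congruence N public

  OnHole : V G → Set
  OnHole u = _∈H_ G u C

  toℕ<N : ∀ (k : Fin L) → toℕ k < N
  toℕ<N k = subst (toℕ k <_) (sym N≡L) (FinP.toℕ<n k)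

  pos : ℕ → Fin L
  pos m = fromℕ< (subst (m % N <_) N≡L (m%n<n m N))

  pos-≈ : ∀ m → toℕ (pos m) ≈ m
  pos-≈ m = ≈-trans (≡⇒≈ (FinP.toℕ-fromℕ< (subst (m % N <_) N≡L (m%n<n m N)))) (%-≈ m)

  cyc : ℕ → V G
  cyc m = Hole.vx C (pos m)

  cyc-cong : ∀ {a b} → a ≈ b → cyc a ≡ cyc b
  cyc-cong {a} {b} e = cong (Hole.vx C) (FinP.toℕ-injective
    (≈-< (toℕ<N (pos a)) (toℕ<N (pos b)) (≈-trans (pos-≈ a) (≈-trans e (≈-sym (pos-≈ b))))))

  cyc-injective : ∀ {a b} → cyc a ≡ cyc b → a ≈ b
  cyc-injective {a} {b} e =
    ≈-trans (≈-sym (pos-≈ a)) (≈-trans (≡⇒≈ (cong toℕ (Hole.inj C _ _ e))) (pos-≈ b))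

  cyc-∈ : ∀ m → OnHole (cyc m)
  cyc-∈ m = pos m , refl

  ∈⇒cyc : ∀ {u} → OnHole u → Σ ℕ λ m → cyc m ≡ u
  ∈⇒cyc (k , refl) = toℕ k , cong (Hole.vx C) (FinP.toℕ-injective (≈-< (toℕ<N _) (toℕ<N k) (pos-≈ (toℕ k))))

  -- the wrap-around edge of the hole is the step from N - 1 to N ≈ 0
  wrap-≈ : ∀ {a c} → a ≡ 0 → c ≡ L → c ≈ a
  wrap-≈ a≡0 c≡L = mod≡ (trans (cong (_% N) (trans c≡L (sym N≡L))) (trans (n%n≡0 N) (cong (_% N) (sym a≡0))))

  ≈N⇒0 : ∀ {b} → b < N → N ≈ b → b ≡ 0
  ≈N⇒0 b<N (mod≡ e) = trans (sym (m<n⇒m%n≡m b<N)) (trans (sym e) (n%n≡0 N))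

  cycAdj⇒cycNbr : ∀ i j → CycAdj L i j → CycNbr (toℕ i) (toℕ j)
  cycAdj⇒cycNbr i j (inj₁ (inj₁ e)) = inj₁ (≡⇒≈ e)
  cycAdj⇒cycNbr i j (inj₁ (inj₂ e)) = inj₂ (≡⇒≈ e)
  cycAdj⇒cycNbr i j (inj₂ (inj₁ (i≡0 , sj≡L))) = inj₂ (wrap-≈ i≡0 sj≡L)
  cycAdj⇒cycNbr i j (inj₂ (inj₂ (j≡0 , si≡L))) = inj₁ (wrap-≈ j≡0 si≡L)

  step⇒cycAdj : ∀ i j → suc (toℕ i) ≈ toℕ j → suc (toℕ i) ≡ toℕ j ⊎ (toℕ j ≡ 0 × suc (toℕ i) ≡ L)
  step⇒cycAdj i j e with m≤n⇒m<n∨m≡n (toℕ<N i)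
  ... | inj₁ si<N = inj₁ (≈-< si<N (toℕ<N j) e)
  ... | inj₂ si≡N = inj₂ (≈N⇒0 (toℕ<N j) (subst (_≈ toℕ j) si≡N e) , trans si≡N N≡L)

  cycNbr⇒cycAdj : ∀ i j → CycNbr (toℕ i) (toℕ j) → CycAdj L i j
  cycNbr⇒cycAdj i j (inj₁ e) = Sum.map inj₁ inj₂ (step⇒cycAdj i j e)
  cycNbr⇒cycAdj i j (inj₂ e) = Sum.map inj₂ inj₁ (step⇒cycAdj j i e)

  adj⇒cycNbr : ∀ a b → Adj G (cyc a) (cyc b) → CycNbr a b
  adj⇒cycNbr a b = CycNbr-cong (pos-≈ a) (pos-≈ b) ∘ cycAdj⇒cycNbr _ _ ∘ to (Hole.adjIff C _ _)

  cycNbr⇒adj : ∀ a b → CycNbr a b → Adj G (cyc a) (cyc b)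
  cycNbr⇒adj a b = from (Hole.adjIff C _ _) ∘ cycNbr⇒cycAdj _ _ ∘ CycNbr-cong (≈-sym (pos-≈ a)) (≈-sym (pos-≈ b))

  -- the position before a
  prev : ℕ → ℕ
  prev a = 3 + (L ∸ 4) + a

  suc-prev : ∀ a → suc (prev a) ≈ a
  suc-prev a = ≈-trans (≡⇒≈ (+-comm N a)) (+N-≈ a)

  ≉suc : ∀ a → ¬ a ≈ suc a
  ≉suc a e with offset-injective {0} {1} a (s≤s z≤n) (s≤s (s≤s z≤n)) e
  ... | ()

  adj-next : ∀ a → Adj G (cyc a) (cyc (suc a))
  adj-next a = cycNbr⇒adj a (suc a) (inj₁ ≈-refl)

  adj-prev : ∀ a → Adj G (cyc a) (cyc (prev a))
  adj-prev a = cycNbr⇒adj a (prev a) (inj₂ (suc-prev a))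

  -- the two hole-neighbours of a vertex are distinct and nonadjacent, as L ≥ 4
  prev≢next : ∀ a → cyc (prev a) ≢ cyc (suc a)
  prev≢next a e with offset-injective {3 + (L ∸ 4)} {1} a (n<1+n _) (s≤s (s≤s z≤n)) (cyc-injective e)
  ... | ()

  prev≁next : ∀ a → ¬ Adj G (cyc (prev a)) (cyc (suc a))
  prev≁next a h with adj⇒cycNbr (prev a) (suc a) h
  ... | inj₁ e = ≉suc a (≈-trans (≈-sym (suc-prev a)) e)
  ... | inj₂ e with offset-injective {2} {3 + (L ∸ 4)} a (s≤s (s≤s (s≤s z≤n))) (n<1+n _) e
  ... | ()

  ∈hole⇒¬simplicial : ∀ {u} → OnHole u → ¬ Simplicial G u
  ∈hole⇒¬simplicial u∈ simp with ∈⇒cyc u∈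
  ... | a , refl = prev≁next a (simp _ _ (adj-prev a) (adj-next a) (prev≢next a))

  -- a position adjacent to both i and i + 1 is one of them, as N ≥ 4
  commonCycNbr : ∀ m i → CycNbr m i → CycNbr m (suc i) → m ≈ i ⊎ m ≈ suc i
  commonCycNbr m i (inj₂ e) _ = inj₂ (≈-sym e)
  commonCycNbr m i (inj₁ e) (inj₁ e′) = inj₁ (suc-cancel e′)
  commonCycNbr m i (inj₁ e) (inj₂ e′)
    with offset-injective {3} {0} i (s≤s (s≤s (s≤s (s≤s z≤n)))) (s≤s z≤n) (≈-trans (suc-cong e′) e)
  ... | ()

  CliqueOnHole : V G → Set
  CliqueOnHole x = ∀ a b → Adj G x (cyc a) → Adj G x (cyc b) → ¬ a ≈ b → Adj G (cyc a) (cyc b)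

  AttachedAt : V G → ℕ → Set
  AttachedAt x i = ∀ m → Adj G x (cyc m) ⇔ (m ≈ i ⊎ m ≈ suc i)

  attachedAt : ∀ x i → CliqueOnHole x → Adj G x (cyc i) → Adj G x (cyc (suc i)) → AttachedAt x i
  attachedAt x i clique xi xi′ m = mk⇔ nbr⇒ ⇒nbr
    where
    equalOrCycNbr : ∀ j → Adj G x (cyc m) → Adj G x (cyc j) → m ≈ j ⊎ CycNbr m j
    equalOrCycNbr j xm xj with m ≈? j
    ... | yes e = inj₁ e
    ... | no m≉j = inj₂ (adj⇒cycNbr m j (clique m j xm xj m≉j))
    nbr⇒ : Adj G x (cyc m) → m ≈ i ⊎ m ≈ suc i
    nbr⇒ xm with equalOrCycNbr i xm xi | equalOrCycNbr (suc i) xm xi′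
    ... | inj₁ e | _ = inj₁ e
    ... | inj₂ _ | inj₁ e = inj₂ e
    ... | inj₂ n | inj₂ n′ = commonCycNbr m i n n′
    ⇒nbr : m ≈ i ⊎ m ≈ suc i → Adj G x (cyc m)
    ⇒nbr (inj₁ e) = subst (Adj G x) (cyc-cong (≈-sym e)) xi
    ⇒nbr (inj₂ e) = subst (Adj G x) (cyc-cong (≈-sym e)) xi′

  rotate : ℕ → Hole G
  rotate i = record
    { len = L ; len≥4 = Hole.len≥4 C ; vx = λ j → cyc (toℕ j + i)
    ; inj = λ j j′ e → FinP.toℕ-injective (offset-injective i (toℕ<N j) (toℕ<N j′) (cyc-injective e))
    ; adjIff = λ j j′ → mk⇔ (cycNbr⇒cycAdj j j′ ∘ CycNbr-unshift i ∘ adj⇒cycNbr _ _)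
                            (cycNbr⇒adj _ _ ∘ CycNbr-shift i ∘ cycAdj⇒cycNbr j j′) }

  ∈rotate⇔∈ : ∀ i u → _∈H_ G u (rotate i) ⇔ OnHole u
  ∈rotate⇔∈ i u = mk⇔ (λ { (j , e) → pos (toℕ j + i) , e }) rotateBack
    where
    rotateBack : OnHole u → _∈H_ G u (rotate i)
    rotateBack u∈ with ∈⇒cyc u∈
    ... | m , refl = pos (m + neg i) , cyc-cong (≈-trans (+-congʳ i (pos-≈ _)) (neg-+ m i))

  clownAt : Even L → ∀ x i → ¬ OnHole x → AttachedAt x i →
            IsClownWithHat G (λ v → OnHole v ⊎ v ≡ x) x
  clownAt even x i x∉C attached = clown , refl , λ v → mk⇔
      [ inj₂ , inj₁ ∘ to (∈rotate⇔∈ i v) ] [ inj₂ ∘ from (∈rotate⇔∈ i v) , inj₁ ]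
    where
    firstTwo : ∀ j → Adj G x (cyc (toℕ j + i)) ⇔ (toℕ j ≡ 0 ⊎ toℕ j ≡ 1)
    firstTwo j = mk⇔
      (Sum.map (offset-injective i (toℕ<N j) (s≤s z≤n)) (offset-injective i (toℕ<N j) (s≤s (s≤s z≤n)))
        ∘ to (attached _))
      (from (attached _) ∘ Sum.map (≡⇒≈ ∘ cong (_+ i)) (≡⇒≈ ∘ cong (_+ i)))
    clown : Clown G
    clown = record { hat = x ; hole = rotate i ; even = even
                   ; hatNot = x∉C ∘ to (∈rotate⇔∈ i x) ; hatAdj = firstTwo }

  twoNbrsAt : ∀ x i → AttachedAt x i → TwoAdjNbrs G x OnHole
  twoNbrsAt x i attached =
    cyc i , cyc (suc i) , cyc-∈ i , cyc-∈ (suc i) , ≉suc i ∘ cyc-injective , adj-next i , nbrs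
    where
    nbrs : ∀ u → OnHole u → Adj G x u ⇔ (u ≡ cyc i ⊎ u ≡ cyc (suc i))
    nbrs u u∈ with ∈⇒cyc u∈
    ... | m , refl = mk⇔ (Sum.map cyc-cong cyc-cong ∘ to (attached m))
                         (from (attached m) ∘ Sum.map cyc-injective cyc-injective)

hole-even : (G : Graph) → Innocent G → (H : Hole G) → Even (Hole.len H)
hole-even G innocent H with 2 ∣? Hole.len H
... | yes even = even
... | no odd = ⊥-elim (Innocent.noOddHole innocent H odd)

NbrAnticompleteTo : (G : Graph) → (V G → Set) → V G → Set
NbrAnticompleteTo G X x = ∃ λ y → Adj G x y × (∀ u → X u → y ≢ u × ¬ Adj G y u)

module ClawFreeHole (G : Graph) (clawFree : ClawFree G) (C : Hole G) where
  open CyclicHole G C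

  -- x, a neighbour y anticomplete to C, and two nonadjacent hole neighbours would form a claw
  anticompleteNbr⇒clique : ∀ x → NbrAnticompleteTo G OnHole x → CliqueOnHole x
  anticompleteNbr⇒clique x (y , xy , yFar) a b xa xb a≉b with adj? G (cyc a) (cyc b)
  ... | yes ab = ab
  ... | no a≁b = ⊥-elim (clawFree x y (cyc a) (cyc b)
      (xy , xa , xb , proj₁ (yFar _ (cyc-∈ a)) , proj₁ (yFar _ (cyc-∈ b)) , a≉b ∘ cyc-injective ,
       proj₂ (yFar _ (cyc-∈ a)) , proj₂ (yFar _ (cyc-∈ b)) , a≁b))

  simplicial⇒clique : ∀ x → Simplicial G x → CliqueOnHole x
  simplicial⇒clique x simp a b xa xb a≉b = simp (cyc a) (cyc b) xa xb (a≉b ∘ cyc-injective)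

  -- if x ∉ C sees cyc a and a clique of C, it is attached at a or at prev a:
  -- if it sees neither hole-neighbour of cyc a, then cyc a is the centre of a claw
  attach : ∀ x → ¬ OnHole x → ∀ a → Adj G x (cyc a) → CliqueOnHole x → Σ ℕ (AttachedAt x)
  attach x x∉C a xa clique with adj? G x (cyc (suc a)) | adj? G x (cyc (prev a))
  ... | yes xa′ | _ = a , attachedAt x a clique xa xa′
  ... | no _ | yes xp = prev a , attachedAt x (prev a) clique xp (subst (Adj G x) (cyc-cong (≈-sym (suc-prev a))) xa)
  ... | no x≁next | no x≁prev = ⊥-elim (clawFree (cyc a) x (cyc (prev a)) (cyc (suc a))
      (adj-sym G xa , adj-prev a , adj-next a , x≢cyc (prev a) , x≢cyc (suc a) ,
       prev≢next a , x≁prev , x≁next , prev≁next a))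
    where
    x≢cyc : ∀ m → x ≢ cyc m
    x≢cyc m e = x∉C (subst OnHole (sym e) (cyc-∈ m))

  hatOfClown : Innocent G → ∀ x → ¬ OnHole x → (∃ λ u → OnHole u × Adj G x u) →
               NbrAnticompleteTo G OnHole x ⊎ Simplicial G x →
               IsClownWithHat G (λ v → OnHole v ⊎ v ≡ x) x × TwoAdjNbrs G x OnHole
  hatOfClown innocent x x∉C (u , u∈C , xu) cliqueReason with ∈⇒cyc u∈C
  ... | a , refl with attach x x∉C a xu ([ anticompleteNbr⇒clique x , simplicial⇒clique x ] cliqueReason)
  ... | i , attached = clownAt (hole-even G innocent C) x i x∉C attached , twoNbrsAt x i attached

trivialPath : (G : Graph) → V G → Path G
trivialPath G v = record
  { len = 0 ; vx = λ _ → v ; inj = λ { zero zero _ → refl }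
  ; adjIff = λ { zero zero → mk⇔ (λ vv → ⊥-elim (subst T (Graph.irrefl G v) vv)) λ { (inj₁ ()) ; (inj₂ ()) } } }

PathToAtFirst : (G : Graph) → ∀ {m} → (Fin (suc m) → V G) → (V G → Set) → Set
PathToAtFirst G p X =
  (∀ i x → X x → p i ≢ x) ×
  (∀ i → i ≢ zero → ∀ x → X x → ¬ Adj G (p i) x) ×
  (∃ λ x → X x × Adj G (p zero) x)

rev-PathTo : (G : Graph) → ∀ {m} (p : Fin (suc m) → V G) (X : V G → Set) →
             PathTo G (rev G p) X → PathToAtFirst G p X
rev-PathTo G {m} p X (disjoint , farOff , (x , x∈ , px)) =
  (λ i x x∈ → subst (λ j → p j ≢ x) (FinP.opposite-involutive i) (disjoint (opposite i) x x∈)) ,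
  (λ i i≢0 x x∈ → subst (λ j → ¬ Adj G (p j) x) (FinP.opposite-involutive i)
     (farOff (opposite i) (i≢0 ∘ opposite≡last⇒zero i) x x∈)) ,
  (x , x∈ , subst (λ j → Adj G (p j) x) opposite-last px)
  where
  opposite-last : opposite (fromℕ m) ≡ zero
  opposite-last = FinP.toℕ-injective (trans (FinP.opposite-prop (fromℕ m))
                    (trans (cong (m ∸_) (FinP.toℕ-fromℕ m)) (n∸n≡0 m)))
  opposite≡last⇒zero : ∀ i → opposite i ≡ fromℕ m → i ≡ zero
  opposite≡last⇒zero i e = trans (sym (FinP.opposite-involutive i)) (trans (cong opposite e) opposite-last)

zero⊎positive : ∀ n → n ≡ 0 ⊎ 1 ≤ n
zero⊎positive zero = inj₁ refl
zero⊎positive (suc n) = inj₂ (s≤s z≤n)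

module PathEnds (G : Graph) (P : Path G) where
  len : ℕ
  len = Path.len P

  vx : Fin (suc len) → V G
  vx = Path.vx P

  adjacent : ∀ i j → Consec i j → Adj G (vx i) (vx j)
  adjacent i j = from (Path.adjIff P i j)

  first≡last : len ≡ 0 → first G P ≡ last G P
  first≡last len≡0 = cong vx (FinP.toℕ-injective (sym (trans (FinP.toℕ-fromℕ len) len≡0)))

  penultimate : 1 ≤ len → Fin (suc len)
  penultimate len≥1 = fromℕ< {m = len ∸ 1} (s≤s (m∸n≤m len 1))

  penultimate-toℕ : ∀ len≥1 → suc (toℕ (penultimate len≥1)) ≡ len
  penultimate-toℕ len≥1 = trans (cong suc (FinP.toℕ-fromℕ< (s≤s (m∸n≤m len 1)))) (m+[n∸m]≡n len≥1)

  penultimate-adj : ∀ len≥1 → Adj G (last G P) (vx (penultimate len≥1))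
  penultimate-adj len≥1 = adj-sym G (adjacent _ _ (inj₁ (trans (penultimate-toℕ len≥1) (sym (FinP.toℕ-fromℕ len)))))

  penultimate≢last : ∀ len≥1 → penultimate len≥1 ≢ fromℕ len
  penultimate≢last len≥1 e = <-irrefl (trans (cong toℕ e) (FinP.toℕ-fromℕ len)) (≤-reflexive (penultimate-toℕ len≥1))

  second : 1 ≤ len → Fin (suc len)
  second len≥1 = fromℕ< {m = 1} (s≤s len≥1)

  second-adj : ∀ len≥1 → Adj G (first G P) (vx (second len≥1))
  second-adj len≥1 = adjacent zero _ (inj₁ (sym (FinP.toℕ-fromℕ< (s≤s len≥1))))

  second≢first : ∀ len≥1 → second len≥1 ≢ zero
  second≢first len≥1 e with trans (sym (FinP.toℕ-fromℕ< (s≤s len≥1))) (cong toℕ e)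
  ... | ()

  penultimate-far : ∀ {X} → PathTo G vx X → 1 ≤ len → NbrAnticompleteTo G X (last G P)
  penultimate-far (disjoint , farOff , _) len≥1 = vx (penultimate len≥1) , penultimate-adj len≥1 ,
    λ u u∈ → disjoint _ u u∈ , farOff _ (penultimate≢last len≥1) u u∈

  second-far : ∀ {X} → PathToAtFirst G vx X → 1 ≤ len → NbrAnticompleteTo G X (first G P)
  second-far (disjoint , farOff , _) len≥1 = vx (second len≥1) , second-adj len≥1 ,
    λ u u∈ → disjoint _ u u∈ , farOff _ (second≢first len≥1) u u∈

safePath-odd : (G : Graph) (C : Hole G) (P : Path G) → Safe G (first G P) →
               PathTo G (Path.vx P) (λ v → _∈H_ G v C) →
               IsClownWithHat G (λ v → _∈H_ G v C ⊎ v ≡ last G P) (last G P) → Odd (Path.len P)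
safePath-odd G C P (_ , safeParity) (disjoint , farOff , _) (D , hat≡last , members) =
  safeParity D P refl (sym hat≡last) awayFromClownHole
  where
  vx : Fin (suc (Path.len P)) → V G
  vx = Path.vx P
  awayFromClownHole : ∀ i → vx i ≢ Clown.hat D → ∀ u → _∈H_ G u (Clown.hole D) → vx i ≢ u × ¬ Adj G (vx i) u
  awayFromClownHole i notHat u u∈D = disjoint i u u∈C , farOff i (notHat ∘ isHat) u u∈C
    where
    isHat : i ≡ fromℕ (Path.len P) → vx i ≡ Clown.hat D
    isHat e = trans (cong vx e) (sym hat≡last)
    -- u is not the hat, which lies off the clown's hole
    notTheHat : u ≡ last G P → _∈H_ G u C
    notTheHat u≡last = ⊥-elim (Clown.hatNot D (subst (λ w → _∈H_ G w (Clown.hole D)) (trans u≡last (sym hat≡last)) u∈D))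
    u∈C : _∈H_ G u C
    u∈C = [ id , notTheHat ] (to (members u) (inj₂ u∈D))

pathToHole : (G : Graph) → ClawFree G → Innocent G → (C : Hole G) (P : Path G) →
    ¬ (_∈H_ G (first G P) C) → PathTo G (Path.vx P) (λ v → _∈H_ G v C) →
    (((1 ≤ Path.len P) ⊎ Safe G (first G P)) →
       IsClownWithHat G (λ v → _∈H_ G v C ⊎ v ≡ last G P) (last G P))
    × (Safe G (first G P) → Odd (Path.len P))
pathToHole G clawFree innocent C P _ pathTo = clownAtEnd , λ safe → safePath-odd G C P safe pathTo (clownAtEnd (inj₂ safe))
  where
  open PathEnds G P
  last∉C : ¬ _∈H_ G (last G P) C
  last∉C x∈C = proj₁ pathTo (fromℕ len) _ x∈C refl
  cliqueReason : 1 ≤ len ⊎ Safe G (first G P) →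
                 NbrAnticompleteTo G (λ v → _∈H_ G v C) (last G P) ⊎ Simplicial G (last G P)
  cliqueReason (inj₁ len≥1) = inj₁ (penultimate-far pathTo len≥1)
  cliqueReason (inj₂ safe) with zero⊎positive len
  ... | inj₁ len≡0 = inj₂ (subst (Simplicial G) (first≡last len≡0) (proj₁ safe))
  ... | inj₂ len≥1 = inj₁ (penultimate-far pathTo len≥1)
  clownAtEnd : 1 ≤ len ⊎ Safe G (first G P) →
               IsClownWithHat G (λ v → _∈H_ G v C ⊎ v ≡ last G P) (last G P)
  clownAtEnd = proj₁ ∘ ClawFreeHole.hatOfClown G clawFree C innocent (last G P) last∉C (proj₂ (proj₂ pathTo)) ∘ cliqueReason

safeAwayFromHoles : (G : Graph) → ClawFree G → Innocent G → (v : V G) → Safe G v → (H : Hole G) →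
                    ¬ (_∈H_ G v H) × (∀ u → _∈H_ G u H → ¬ Adj G v u)
safeAwayFromHoles G clawFree innocent v safe H =
  v∉H , λ u u∈H vu → proj₂ (pathToHole G clawFree innocent H P v∉H (pathTo u u∈H vu)) safe (2 ∣0)
  where
  v∉H : ¬ _∈H_ G v H
  v∉H v∈H = CyclicHole.∈hole⇒¬simplicial G H v∈H (proj₁ safe)
  P : Path G
  P = trivialPath G v
  pathTo : ∀ u → _∈H_ G u H → Adj G v u → PathTo G (Path.vx P) (λ w → _∈H_ G w H)
  pathTo u u∈H vu =
    (λ _ w w∈H v≡w → v∉H (subst (λ z → _∈H_ G z H) (sym v≡w) w∈H)) ,
    (λ { zero 0≢0 → ⊥-elim (0≢0 refl) }) ,
    (u , u∈H , vu)

pathBetweenHoles : (G : Graph) → ClawFree G → Innocent G → (C₁ C₂ : Hole G) (Q : Path G) →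
    Anticomplete G (λ v → _∈H_ G v C₁) (λ v → _∈H_ G v C₂) →
    PathTo G (Path.vx Q) (λ v → _∈H_ G v C₂) →
    PathTo G (rev G (Path.vx Q)) (λ v → _∈H_ G v C₁) →
    Even (Path.len Q)
    × IsClownWithHat G (λ v → _∈H_ G v C₁ ⊎ v ≡ first G Q) (first G Q)
    × IsClownWithHat G (λ v → _∈H_ G v C₂ ⊎ v ≡ last G Q) (last G Q)
pathBetweenHoles G clawFree innocent C₁ C₂ Q anticomplete toC₂ revToC₁ = evenQ , proj₁ end₁ , proj₁ end₂
  where
  open PathEnds G Q
  toC₁ : PathToAtFirst G vx (λ v → _∈H_ G v C₁)
  toC₁ = rev-PathTo G vx _ revToC₁
  -- a neighbour of the first vertex anticomplete to C₁: the second vertex, or a vertex of C₂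
  far₁ : NbrAnticompleteTo G (λ v → _∈H_ G v C₁) (first G Q)
  far₁ with zero⊎positive len | proj₂ (proj₂ toC₂)
  ... | inj₂ len≥1 | _ = second-far toC₁ len≥1
  ... | inj₁ len≡0 | w , w∈C₂ , xw = w , subst (λ z → Adj G z w) (sym (first≡last len≡0)) xw ,
      λ u u∈C₁ → (λ w≡u → proj₁ (anticomplete u w u∈C₁ w∈C₂) (sym w≡u)) ,
                 (λ wu → proj₂ (anticomplete u w u∈C₁ w∈C₂) (adj-sym G wu))
  far₂ : NbrAnticompleteTo G (λ v → _∈H_ G v C₂) (last G Q)
  far₂ with zero⊎positive len | proj₂ (proj₂ toC₁)
  ... | inj₂ len≥1 | _ = penultimate-far toC₂ len≥1
  ... | inj₁ len≡0 | w , w∈C₁ , xw = w , subst (λ z → Adj G z w) (first≡last len≡0) xw ,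
      λ u u∈C₂ → anticomplete w u w∈C₁ u∈C₂
  end₁ : IsClownWithHat G (λ v → _∈H_ G v C₁ ⊎ v ≡ first G Q) (first G Q) × TwoAdjNbrs G (first G Q) (λ v → _∈H_ G v C₁)
  end₁ = ClawFreeHole.hatOfClown G clawFree C₁ innocent (first G Q) (λ x∈ → proj₁ toC₁ zero _ x∈ refl) (proj₂ (proj₂ toC₁)) (inj₁ far₁)
  end₂ : IsClownWithHat G (λ v → _∈H_ G v C₂ ⊎ v ≡ last G Q) (last G Q) × TwoAdjNbrs G (last G Q) (λ v → _∈H_ G v C₂)
  end₂ = ClawFreeHole.hatOfClown G clawFree C₂ innocent (last G Q) (λ x∈ → proj₁ toC₂ (fromℕ len) _ x∈ refl) (proj₂ (proj₂ toC₂)) (inj₁ far₂)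
  -- an odd Q, with the two clowns at its ends, would be a handcuff
  evenQ : Even len
  evenQ with 2 ∣? len
  ... | yes even = even
  ... | no odd = ⊥-elim (Innocent.noHandcuff innocent (record
        { C₁ = C₁ ; C₂ = C₂ ; even₁ = hole-even G innocent C₁ ; even₂ = hole-even G innocent C₂
        ; P = Q ; oddP = odd ; anti12 = anticomplete
        ; disj₁ = proj₁ toC₁ ; disj₂ = proj₁ toC₂ ; two₁ = proj₂ end₁ ; two₂ = proj₂ end₂
        ; none₁ = proj₁ (proj₂ toC₁) ; none₂ = proj₁ (proj₂ toC₂) }))

mainTheorem4 : (G : Graph) → ClawFree G → Innocent G →
    -- (1)
    ((C : Hole G) (P : Path G) →
      ¬ (_∈H_ G (first G P) C) →
      PathTo G (Path.vx P) (λ v → _∈H_ G v C) →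
      (((1 ≤ Path.len P) ⊎ Safe G (first G P)) →
         IsClownWithHat G (λ v → _∈H_ G v C ⊎ v ≡ last G P) (last G P))
      × (Safe G (first G P) → Odd (Path.len P)))
    ×
    -- (2)
    ((v : V G) → Safe G v → (H : Hole G) →
      ¬ (_∈H_ G v H) × (∀ u → _∈H_ G u H → ¬ Adj G v u))
    ×
    -- (3)
    ((C₁ C₂ : Hole G) (Q : Path G) →
      Anticomplete G (λ v → _∈H_ G v C₁) (λ v → _∈H_ G v C₂) →
      PathTo G (Path.vx Q) (λ v → _∈H_ G v C₂) →
      PathTo G (rev G (Path.vx Q)) (λ v → _∈H_ G v C₁) →
      Even (Path.len Q)
      × IsClownWithHat G (λ v → _∈H_ G v C₁ ⊎ v ≡ first G Q) (first G Q)
      × IsClownWithHat G (λ v → _∈H_ G v C₂ ⊎ v ≡ last G Q) (last G Q))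
mainTheorem4 G clawFree innocent =
  pathToHole G clawFree innocent ,
  safeAwayFromHoles G clawFree innocent ,
  pathBetweenHoles G clawFree innocent
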